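{- Let $(G,L)$ be a minimal list-obstruction, let $R$ be an induced subgraph of $G$, and let $\mathcal{L}=\{L_1,\dots,L_m\}$ be a refinement of $L$ with respect to $R$. For every $i$, let $(G_{L_i},L_i)$ be a minimal list-obstruction induced by $(G,L_i)$. Then $V(G)=V(R)\cup\bigcup_{i=1}^m V(G_{L_i})$. Moreover, if each $G_{L_i}$ can be chosen such that $|V(G_{L_i})\setminus V(R)|\le k$, then $|V(G)|\le |V(R)|+km$.
   Context: Lists are subsets of $\{1,2,3\}$. A list system $L$ of a finite simple graph $G$ assigns to each vertex $v$ a set $L(v)\subseteq\{1,2,3\}$; an $L$-coloring is a proper coloring $c$ with $c(v)\in L(v)$; $(G,L)$ is a list-obstruction if it has no $L$-coloring, and a minimal list-obstruction if moreover $(A,L|_{V(A)})$ has an $L$-coloring for every proper induced subgraph $A$. A subsystem of $L$ is a list system $L'$ with $L'(v)\subseteq L(v)$ for all $v$. If $(G,L')$ is a list-obstruction, a minimal list-obstruction induced by $(G,L')$ is a pair $(G',L'|_{V(G')})$ with $G'$ an induced subgraph of $G$ that is a minimal list-obstruction. A refinement of $L$ with respect to an induced subgraph $R$ of $G$ is a set $\mathcal L$ of subsystems of $L$ such that: (1) for every $L'\in\mathcal L$ there is an induced subgraph $R(L')$ of $R$ with $|L'(v)|=1$ for all $v\in V(R(L'))$; (2) for each $L'\in\mathcal L$, $L'(v)=L(v)$ for $v\notin V(R(L'))$ and $L'(v)\subseteq L(v)$ for $v\in V(R(L'))$; (3) for every $L$-coloring $c$ of $R$ there is $L'\in\mathcal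 L$ with $c(v)\in L'(v)$ for all $v\in V(R(L'))$. -}

module Defs where

open import Data.Nat using (ℕ)
open import Data.Bool using (Bool; true)
open import Data.Fin using (Fin)
open import Data.Fin.Subset using (Subset; _∈_; _∉_; _⊆_; _⊂_; ∣_∣)
open import Data.Product using (Σ; _×_)
open import Relation.Binary.PropositionalEquality using (_≡_; _≢_)
open import Relation.Nullary using (¬_)

record Graph (n : ℕ) : Set where
  field
    adj   : Fin n → Fin n → Bool
    sym   : ∀ u v → adj u v ≡ adj v u
    irrefl : ∀ v → adj v v ≢ true

Colour : Set
Colour = Fin 3

ListSystem : ℕ → Set
ListSystem n = Fin n → Subset 3

-- Induced subgraphs of G are given by their vertex sets S : Subset n.
-- An L-coloring of the induced subgraph G[S]: a map c (its values outside S
-- are irrelevant) that is proper on G[S] and respects the lists on S.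
IsLColouring : ∀ {n} → Graph n → Subset n → ListSystem n → (Fin n → Colour) → Set
IsLColouring G S L c =
  (∀ v → v ∈ S → c v ∈ L v) ×
  (∀ u v → u ∈ S → v ∈ S → Graph.adj G u v ≡ true → c u ≢ c v)

Colourable : ∀ {n} → Graph n → Subset n → ListSystem n → Set
Colourable G S L = Σ (Fin _ → Colour) (IsLColouring G S L)

ListObstruction : ∀ {n} → Graph n → Subset n → ListSystem n → Set
ListObstruction G S L = ¬ Colourable G S L

MinimalListObstruction : ∀ {n} → Graph n → Subset n → ListSystem n → Set
MinimalListObstruction G S L =
  ListObstruction G S L × (∀ S' → S' ⊂ S → Colourable G S' L)

record Refinement {n : ℕ} (G : Graph n) (L : ListSystem n) (R : Subset n) (m : ℕ) : Set where
  field
    Ls : Fin m → ListSystem n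
    Rs : Fin m → Subset n
    Rs⊆R      : ∀ i → Rs i ⊆ R
    singleton : ∀ i v → v ∈ Rs i → ∣ Ls i v ∣ ≡ 1
    outside   : ∀ i v → v ∉ Rs i → Ls i v ≡ L v
    inside    : ∀ i v → v ∈ Rs i → Ls i v ⊆ L v
    covers    : ∀ c → IsLColouring G R L c → Σ (Fin m) λ i → ∀ v → v ∈ Rs i → c v ∈ Ls i v

-- Every vertex v of a minimal list-obstruction (G, L) outside R lies in some G_Lᵢ:
-- deleting v leaves an L-colourable graph, whose colouring on R is matched by some
-- Lᵢ of the refinement, and is then also an Lᵢ-colouring of G − v. Since G_Lᵢ is
-- not Lᵢ-colourable, it cannot avoid v. The bound on |V(G)| follows by counting
-- V(G) ⊆ V(R) ∪ ⋃ᵢ (V(G_Lᵢ) ∖ V(R)).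
module Submission where

open import Defs
open import Data.Nat using (ℕ; _≤_; _+_; _*_; zero; suc; z≤n; s≤s)
open import Data.Nat.Properties
  using (≤-trans; ≤-reflexive; n≤1+n; +-suc; +-mono-≤; +-monoʳ-≤; *-zeroʳ; *-suc; module ≤-Reasoning)
open import Data.Fin as Fin using (Fin)
open import Data.Fin.Subset using (Subset; ⊤; ⊥; _∈_; _∉_; _⊆_; _⊂_; _∪_; _─_; ∁; ⁅_⁆; ∣_∣; inside; outside)
open import Data.Fin.Subset.Properties
  using (_∈?_; ∈⊤; ⊆⊤; x∈⁅x⁆; x∈⁅y⁆⇒x≡y; x∉p⇒x∈∁p; x∈p⇒x∉∁p; x∈p∪q⁺; x∈p∧x∉q⇒x∈p─q;
         ∣⊤∣≡n; ∣⊥∣≡0; p⊆q⇒∣p∣≤∣q∣)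
open import Data.Vec using (_∷_; [])
open import Data.Product using (Σ; _×_; _,_; proj₁)
open import Data.Sum using (_⊎_; inj₁; inj₂)
open import Function using (_∘_)
open import Data.Empty using (⊥-elim)
open import Relation.Nullary using (yes; no)
open import Relation.Binary.PropositionalEquality using (_≡_; sym; trans; subst)

private
  variable
    n m : ℕ

∣p∪q∣≤∣p∣+∣q∣ : ∀ (p q : Subset n) → ∣ p ∪ q ∣ ≤ ∣ p ∣ + ∣ q ∣
∣p∪q∣≤∣p∣+∣q∣ []            []            = z≤n
∣p∪q∣≤∣p∣+∣q∣ (outside ∷ p) (outside ∷ q) = ∣p∪q∣≤∣p∣+∣q∣ p q
∣p∪q∣≤∣p∣+∣q∣ (inside  ∷ p) (outside ∷ q) = s≤s (∣p∪q∣≤∣p∣+∣q∣ p q)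
∣p∪q∣≤∣p∣+∣q∣ (outside ∷ p) (inside  ∷ q) =
  ≤-trans (s≤s (∣p∪q∣≤∣p∣+∣q∣ p q)) (≤-reflexive (sym (+-suc ∣ p ∣ ∣ q ∣)))
∣p∪q∣≤∣p∣+∣q∣ (inside  ∷ p) (inside  ∷ q) =
  s≤s (≤-trans (∣p∪q∣≤∣p∣+∣q∣ p q) (+-monoʳ-≤ ∣ p ∣ (n≤1+n ∣ q ∣)))

x∉p⇒p⊆∁⁅x⁆ : ∀ {p : Subset n} {x} → x ∉ p → p ⊆ ∁ ⁅ x ⁆
x∉p⇒p⊆∁⁅x⁆ {p = p} x∉p y∈p = x∉p⇒x∈∁p (λ y∈⁅x⁆ → x∉p (subst (_∈ p) (x∈⁅y⁆⇒x≡y _ y∈⁅x⁆) y∈p))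

∁⁅x⁆⊂⊤ : ∀ (x : Fin n) → ∁ ⁅ x ⁆ ⊂ ⊤
∁⁅x⁆⊂⊤ x = ⊆⊤ , x , ∈⊤ , x∈p⇒x∉∁p (x∈⁅x⁆ x)

⋃ⁱ : (Fin m → Subset n) → Subset n
⋃ⁱ {zero}  f = ⊥
⋃ⁱ {suc m} f = f Fin.zero ∪ ⋃ⁱ (f ∘ Fin.suc)

x∈fi⇒x∈⋃ⁱf : ∀ (f : Fin m → Subset n) i {x} → x ∈ f i → x ∈ ⋃ⁱ f
x∈fi⇒x∈⋃ⁱf f Fin.zero    x∈fi = x∈p∪q⁺ (inj₁ x∈fi)
x∈fi⇒x∈⋃ⁱf f (Fin.suc i) x∈fi = x∈p∪q⁺ (inj₂ (x∈fi⇒x∈⋃ⁱf (f ∘ Fin.suc) i x∈fi))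

∣⋃ⁱf∣≤k*m : ∀ (f : Fin m → Subset n) k → (∀ i → ∣ f i ∣ ≤ k) → ∣ ⋃ⁱ f ∣ ≤ k * m
∣⋃ⁱf∣≤k*m {zero}  {n} f k _ = ≤-reflexive (trans (∣⊥∣≡0 n) (sym (*-zeroʳ k)))
∣⋃ⁱf∣≤k*m {suc m} f k ∣fi∣≤k = begin
  ∣ f Fin.zero ∪ ⋃ⁱ (f ∘ Fin.suc) ∣       ≤⟨ ∣p∪q∣≤∣p∣+∣q∣ (f Fin.zero) _ ⟩
  ∣ f Fin.zero ∣ + ∣ ⋃ⁱ (f ∘ Fin.suc) ∣   ≤⟨ +-mono-≤ (∣fi∣≤k Fin.zero) (∣⋃ⁱf∣≤k*m (f ∘ Fin.suc) k (∣fi∣≤k ∘ Fin.suc)) ⟩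
  k + k * m                               ≡⟨ sym (*-suc k m) ⟩
  k * suc m                               ∎
  where open ≤-Reasoning

n≤∣p∣+k*m : ∀ (p : Subset n) (f : Fin m → Subset n) k → (∀ {x} → x ∉ p → Σ (Fin m) λ i → x ∈ f i) →
            (∀ i → ∣ f i ─ p ∣ ≤ k) → n ≤ ∣ p ∣ + k * m
n≤∣p∣+k*m {n = n} {m = m} p f k ∉p⇒∈f ∣fi─p∣≤k = begin
  n                              ≡⟨ sym (∣⊤∣≡n n) ⟩
  ∣ ⊤ {n} ∣                      ≤⟨ p⊆q⇒∣p∣≤∣q∣ ⊤⊆p∪⋃ⁱf─p ⟩
  ∣ p ∪ ⋃ⁱ f─p ∣                 ≤⟨ ∣p∪q∣≤∣p∣+∣q∣ p _ ⟩
  ∣ p ∣ + ∣ ⋃ⁱ f─p ∣             ≤⟨ +-monoʳ-≤ ∣ p ∣ (∣⋃ⁱf∣≤k*m f─p k ∣fi─p∣≤k) ⟩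
  ∣ p ∣ + k * m                  ∎
  where
  open ≤-Reasoning
  f─p : Fin _ → Subset _
  f─p i = f i ─ p
  ⊤⊆p∪⋃ⁱf─p : ⊤ ⊆ p ∪ ⋃ⁱ f─p
  ⊤⊆p∪⋃ⁱf─p {x} _ with x ∈? p
  ... | yes x∈p = x∈p∪q⁺ (inj₁ x∈p)
  ... | no  x∉p with ∉p⇒∈f x∉p
  ...   | i , x∈fi = x∈p∪q⁺ (inj₂ (x∈fi⇒x∈⋃ⁱf f─p i (x∈p∧x∉q⇒x∈p─q x∈fi x∉p)))

module _ {n} (G : Graph n) where

  IsLColouring-⊆ : ∀ {S T L c} → T ⊆ S → IsLColouring G S L c → IsLColouring G T L c
  IsLColouring-⊆ T⊆S (c∈L , proper) =
    (λ v → c∈L v ∘ T⊆S) , (λ u v u∈T v∈T → proper u v (T⊆S u∈T) (T⊆S v∈T))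

  Colourable-⊆ : ∀ {S T L} → T ⊆ S → Colourable G S L → Colourable G T L
  Colourable-⊆ T⊆S (c , c-col) = c , IsLColouring-⊆ T⊆S c-col

  IsLColouring-shrink : ∀ {S L L' c} (Q : Subset n) → (∀ v → v ∉ Q → L' v ≡ L v) →
                        (∀ v → v ∈ Q → c v ∈ L' v) → IsLColouring G S L c → IsLColouring G S L' c
  IsLColouring-shrink {S} {L' = L'} {c} Q L'≡L c∈L'-on-Q (c∈L , proper) = c∈L' , proper
    where
    c∈L' : ∀ v → v ∈ S → c v ∈ L' v
    c∈L' v v∈S with v ∈? Q
    ... | yes v∈Q = c∈L'-on-Q v v∈Q
    ... | no  v∉Q = subst (c v ∈_) (sym (L'≡L v v∉Q)) (c∈L v v∈S)

  module _ {L : ListSystem n} {R : Subset n} {m} (ℛ : Refinement G L R m) where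
    open Refinement ℛ using (Ls; Rs; covers) renaming (outside to Ls≡L-outside-Rs)

    IsLColouring-refine : ∀ {S c} → R ⊆ S → IsLColouring G S L c →
                          Σ (Fin m) λ i → IsLColouring G S (Ls i) c
    IsLColouring-refine R⊆S c-col with covers _ (IsLColouring-⊆ R⊆S c-col)
    ... | i , c∈Lsi = i , IsLColouring-shrink (Rs i) (Ls≡L-outside-Rs i) c∈Lsi c-col

    Colourable-refine : ∀ {S} → R ⊆ S → Colourable G S L → Σ (Fin m) λ i → Colourable G S (Ls i)
    Colourable-refine R⊆S (c , c-col) with IsLColouring-refine R⊆S c-col
    ... | i , c-colᵢ = i , c , c-colᵢ

    ∉R⇒∈obstruction : (Gs : Fin m → Subset n) → (∀ i → ListObstruction G (Gs i) (Ls i)) →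
                      ∀ {v} → v ∉ R → Colourable G (∁ ⁅ v ⁆) L → Σ (Fin m) λ i → v ∈ Gs i
    ∉R⇒∈obstruction Gs obstruction v∉R G-v-col
      with Colourable-refine (x∉p⇒p⊆∁⁅x⁆ v∉R) G-v-col
    ... | i , G-v-colᵢ with _ ∈? Gs i
    ...   | yes v∈Gsᵢ = i , v∈Gsᵢ
    ...   | no  v∉Gsᵢ = ⊥-elim (obstruction i (Colourable-⊆ (x∉p⇒p⊆∁⁅x⁆ v∉Gsᵢ) G-v-colᵢ))

lemma4 : ∀ {n m : ℕ} (G : Graph n) (L : ListSystem n) (R : Subset n)
    → MinimalListObstruction G ⊤ L
    → (ℛ : Refinement G L R m)
    → (Gs : Fin m → Subset n)
    → (∀ i → MinimalListObstruction G (Gs i) (Refinement.Ls ℛ i))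
    → (∀ v → v ∈ R ⊎ Σ (Fin m) (λ i → v ∈ Gs i))
    × (∀ k → (∀ i → ∣ Gs i ─ R ∣ ≤ k) → n ≤ ∣ R ∣ + k * m)
lemma4 G L R (_ , proper-parts-colourable) ℛ Gs minimal = covered , λ k → n≤∣p∣+k*m R Gs k ∉R⇒∈Gs
  where
  ∉R⇒∈Gs : ∀ {v} → v ∉ R → Σ (Fin _) λ i → v ∈ Gs i
  ∉R⇒∈Gs {v} v∉R =
    ∉R⇒∈obstruction G ℛ Gs (proj₁ ∘ minimal) v∉R (proper-parts-colourable (∁ ⁅ v ⁆) (∁⁅x⁆⊂⊤ v))

  covered : ∀ v → v ∈ R ⊎ Σ (Fin _) λ i → v ∈ Gs i
  covered v with v ∈? R
  ... | yes v∈R = inj₁ v∈R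
  ... | no  v∉R = inj₂ (∉R⇒∈Gs v∉R)
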